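{- Let $\{P_n(x)\}_{n\ge 1}$ and the coefficients $b_i(n)$ be as defined in the context, and let $m=\lfloor\frac{n-1}{2}\rfloor$. (1) For odd $n$, the numbers $b_j(n)/n$, $j=0,\dots,m-1$, are integers; moreover, for odd $n\ge3$, $b_i(n)=n\big(b_i(n-1)+b_{i-1}(n-1)\big)$ for $i=1,\dots,m-1$. (2) For even $n\ge4$, $2b_i(n)=b_i(n-1)+b_{i-1}(n-1)+m!\binom{m}{i}$ for $i=1,\dots,m-1$.
   Context: The sequence $\{P_n(x)\}_{n\ge1}$ of rational functions of $x$ is defined by $P_1=P_2=1$ and, for $n\ge 2$: if $n$ is odd, $4(2x+n)P_{n+1}(x)=2(x+n)P_n(x)+(2x+n)P_n(x+1)+(4x+n)\ell_n(x)$; if $n$ is even, $4P_{n+1}(x)=4(x+n)P_n(x)+2(2x+n+1)P_n(x+1)+(4x+n)\ell_{n-1}(x)$. Here for odd $r\ge1$, $\ell_r(x)=\prod_{j=1}^{(r-1)/2}(x+j)$ (the empty product equals $1$). Each $P_n$ is a polynomial of degree $m(n)=\lfloor\frac{n-1}{2}\rfloor$; its coefficients in the binomial basis are defined by $P_n(x)=\sum_{i=0}^{m(n)}b_i(n)\binom{x}{m(n)-i}$ (so $b_i(n-1)$ refers to the expansion of $P_{n-1}$ with respect to its own degree $m(n-1)$). -}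

module Defs where

open import Data.Bool using (Bool; true; false; if_then_else_)
open import Data.Nat as ℕ using (ℕ; zero; suc; _∸_)
open import Data.Integer using (ℤ; +_)
open import Data.Rational using (ℚ; _/_; _+_; _*_; 0ℚ; 1ℚ)
open import Data.Nat.Combinatorics using (_C_)
open import Relation.Binary.PropositionalEquality using (_≡_)

ℕ→ℚ : ℕ → ℚ
ℕ→ℚ n = + n / 1

ℤ→ℚ : ℤ → ℚ
ℤ→ℚ z = z / 1

isOdd : ℕ → Bool
isOdd zero = false
isOdd (suc n) = if isOdd n then false else true

deg : ℕ → ℕ
deg n = (n ∸ 1) ℕ./ 2

prodUp : ℕ → ℕ → ℕ
prodUp zero x = 1
prodUp (suc t) x = prodUp t x ℕ.* (x ℕ.+ suc t)

ell : ℕ → ℕ → ℕ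
ell r x = prodUp ((r ∸ 1) ℕ./ 2) x

-- P n x = P_n(x) evaluated at the natural number x (x ≥ 0, never a pole
-- of the recurrence since 2x+n > 0).  P 0 is a dummy (the sequence starts at 1).
-- For n = k + 2 ≥ 2:
--   n odd : P_{n+1}(x) = [2(x+n)P_n(x) + (2x+n)P_n(x+1) + (4x+n)ℓ_n(x)] / (4(2x+n)),
--           where 4(2x+n) = 8x+4k+8 = suc (8x+4k+7)
--   n even: P_{n+1}(x) = [4(x+n)P_n(x) + 2(2x+n+1)P_n(x+1) + (4x+n)ℓ_{n-1}(x)] / 4
P : ℕ → ℕ → ℚ
P zero x = 0ℚ
P (suc zero) x = 1ℚ
P (suc (suc zero)) x = 1ℚ
P (suc (suc (suc k))) x =
  if isOdd n
  then (ℕ→ℚ (2 ℕ.* (x ℕ.+ n)) * P (suc (suc k)) x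
         + ℕ→ℚ (2 ℕ.* x ℕ.+ n) * P (suc (suc k)) (suc x)
         + ℕ→ℚ (4 ℕ.* x ℕ.+ n) * ℕ→ℚ (ell n x))
       * (+ 1 / suc (8 ℕ.* x ℕ.+ 4 ℕ.* k ℕ.+ 7))
  else (ℕ→ℚ (4 ℕ.* (x ℕ.+ n)) * P (suc (suc k)) x
         + ℕ→ℚ (2 ℕ.* (2 ℕ.* x ℕ.+ n ℕ.+ 1)) * P (suc (suc k)) (suc x)
         + ℕ→ℚ (4 ℕ.* x ℕ.+ n) * ℕ→ℚ (ell (n ∸ 1) x))
       * (+ 1 / 4)
  where
  n : ℕ
  n = suc (suc k)

sumTo : ℕ → (ℕ → ℚ) → ℚ
sumTo zero f = f zero
sumTo (suc m) f = sumTo m f + f (suc m)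

-- b (indices 0..m(n)) are the coefficients of P_n in the binomial basis:
-- P_n(x) = Σ_{i=0}^{m(n)} b_i binom(x, m(n) - i), as an identity of
-- functions on ℕ (which determines a polynomial uniquely).
IsBinomCoeffs : ℕ → (ℕ → ℚ) → Set
IsBinomCoeffs n b =
  ∀ (x : ℕ) → P n x ≡ sumTo (deg n) (λ i → b i * ℕ→ℚ (x C (deg n ∸ i)))

{-# OPTIONS --safe #-}
-- Write Pₒ m = P_{2m+1}, Pₑ m = P_{2m+2} and ℓ m = ℓ_{2m+1}. A simultaneous induction on m,
-- driven by the defining recurrences, gives 2 Pₑ m x = Pₒ m (x+1) + ℓ m x together with
-- first-order difference equations in x for Pₒ m and Pₑ m; they imply
-- Pₒ (m+1) (x+1) − Pₒ (m+1) x = (2m+3) Pₑ m (x+1).  In the Newton basis C(x,k) the forward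
-- difference shifts coefficients by one and ℓ m x = m! Σ_k C(m,k) C(x,k), so comparing
-- Newton coefficients (which are unique) gives the recurrences (1b) and (2); the b_i of the
-- statement are these coefficients read from the top, k = m − i.  For (1a), a parity argument
-- on the difference equation of Pₑ m shows that it takes natural values, so its Newton
-- coefficients are integers, and the difference identity makes b_j(n) a multiple of n for j < m.
module Submission where

open import Defs
open import Data.Bool using (true; false)
open import Data.Nat using (ℕ; _∸_; _≤_; _<_; _!)
import Data.Nat as ℕ
open import Data.Nat.Combinatorics using (_C_)
open import Data.Integer using (ℤ)
open import Data.Rational using (ℚ; _+_; _*_)
open import Data.Product using (_×_; ∃)
open import Relation.Binary.PropositionalEquality using (_≡_)

open import Agda.Builtin.FromNat using (Number; fromNat)
open import Data.Bool using (if_then_else_)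
open import Data.List using (_∷_; [])
open import Data.Nat using (zero; suc; z≤n; s≤s)
import Data.Nat.Literals as ℕ
import Data.Nat.Properties as ℕₚ
open import Data.Nat.DivMod using (m*n/n≡m; +-distrib-/-∣ʳ)
open import Data.Nat.Divisibility using (divides; divides-refl; _∣_; ∣m+n∣m⇒∣n; m∣m*n)
open import Data.Nat.Combinatorics using (nCk+nC[k+1]≡[n+1]C[k+1]; k>n⇒nCk≡0; nCk≡nC[n∸k])
open import Data.Nat.Coprimality using (1-coprimeTo) renaming (sym to coprime-sym)
import Data.Nat.Tactic.RingSolver as ℕ-Solver
open import Data.Integer using (-[1+_])
import Data.Integer as ℤ
import Data.Integer.Properties as ℤₚ
open import Data.Rational using (0ℚ; -_; _-_; ↥_)
import Data.Rational as ℚ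
import Data.Rational.Literals as ℚ
import Data.Rational.Properties as ℚₚ
open import Data.Product using (_,_; proj₁; proj₂; map₂)
open import Data.Sum using (_⊎_; inj₁; inj₂)
open import Level using (0ℓ)
open import Relation.Binary.PropositionalEquality using (refl; sym; trans; cong; cong₂; subst; module ≡-Reasoning)
open import Relation.Nullary.Decidable using (dec⇒maybe)
open import Data.Unit using (tt)  -- discharges the instance constraint of ℚ literals
open import Tactic.RingSolver using (solve-∀; solve)
open import Algebra.Properties.Group ℚₚ.+-0-group using () renaming (∙-cancelˡ to +-cancelˡ; ∙-cancelʳ to +-cancelʳ)
open import Tactic.RingSolver.Core.AlmostCommutativeRing using (AlmostCommutativeRing; fromCommutativeRing)

instance
  ℕ-number : Number ℕ
  ℕ-number = ℕ.number
  ℚ-number : Number ℚ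
  ℚ-number = ℚ.number

ℚ-ring : AlmostCommutativeRing 0ℓ 0ℓ
ℚ-ring = fromCommutativeRing ℚₚ.+-*-commutativeRing (λ p → dec⇒maybe (0ℚ ℚ.≟ p))

⟦_⟧ : ℕ → ℚ
⟦_⟧ = ℕ→ℚ

ℤ→ℚ≡fromℤ : ∀ z → ℤ→ℚ z ≡ ℚ.fromℤ z
ℤ→ℚ≡fromℤ (ℤ.+ n)    = ℚₚ.normalize-coprime (coprime-sym (1-coprimeTo n))
ℤ→ℚ≡fromℤ -[1+ n ] = cong -_ (ℚₚ.normalize-coprime (coprime-sym (1-coprimeTo (suc n))))

ℤ→ℚ-+ : ∀ a b → ℤ→ℚ (a ℤ.+ b) ≡ ℤ→ℚ a + ℤ→ℚ b
ℤ→ℚ-+ a b = begin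
  ℤ→ℚ (a ℤ.+ b)                 ≡⟨ cong₂ (λ u v → ℤ→ℚ (u ℤ.+ v)) (sym (ℤₚ.*-identityʳ a)) (sym (ℤₚ.*-identityʳ b)) ⟩
  ℚ.fromℤ a + ℚ.fromℤ b         ≡⟨ sym (cong₂ _+_ (ℤ→ℚ≡fromℤ a) (ℤ→ℚ≡fromℤ b)) ⟩
  ℤ→ℚ a + ℤ→ℚ b                 ∎
  where open ≡-Reasoning

ℤ→ℚ-neg : ∀ z → ℤ→ℚ (ℤ.- z) ≡ - ℤ→ℚ z
ℤ→ℚ-neg (ℤ.+ zero)  = refl
ℤ→ℚ-neg (ℤ.+ suc n) = refl
ℤ→ℚ-neg -[1+ n ]  = trans (ℤ→ℚ≡fromℤ (ℤ.+ suc n)) (cong (λ p → - (- p)) (sym (ℤ→ℚ≡fromℤ (ℤ.+ suc n))))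

ℕ→ℚ-+ : ∀ a b → ⟦ a ℕ.+ b ⟧ ≡ ⟦ a ⟧ + ⟦ b ⟧
ℕ→ℚ-+ a b = ℤ→ℚ-+ (ℤ.+ a) (ℤ.+ b)

ℕ→ℚ-* : ∀ a b → ⟦ a ℕ.* b ⟧ ≡ ⟦ a ⟧ * ⟦ b ⟧
ℕ→ℚ-* a b = trans (cong ℤ→ℚ (ℤₚ.pos-* a b)) (sym (cong₂ _*_ (ℤ→ℚ≡fromℤ (ℤ.+ a)) (ℤ→ℚ≡fromℤ (ℤ.+ b))))

ℕ→ℚ-suc : ∀ a → ⟦ suc a ⟧ ≡ 1 + ⟦ a ⟧
ℕ→ℚ-suc = ℕ→ℚ-+ 1

ℕ→ℚ-injective : ∀ {a b} → ⟦ a ⟧ ≡ ⟦ b ⟧ → a ≡ b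
ℕ→ℚ-injective {a} {b} eq =
  ℤₚ.+-injective (cong ↥_ (trans (sym (ℤ→ℚ≡fromℤ (ℤ.+ a))) (trans eq (ℤ→ℚ≡fromℤ (ℤ.+ b)))))

*-inverse-cancelˡ : ∀ s i → s * i ≡ 1 → ∀ r → s * (i * r) ≡ r
*-inverse-cancelˡ s i s*i≡1 r = begin
  s * (i * r)  ≡⟨ solve (s ∷ i ∷ r ∷ []) ℚ-ring ⟩
  s * i * r    ≡⟨ cong (_* r) s*i≡1 ⟩
  1 * r        ≡⟨ solve (r ∷ []) ℚ-ring ⟩
  r            ∎
  where open ≡-Reasoning

*-cancelˡ-invertible : ∀ s i → s * i ≡ 1 → ∀ {p q} → s * p ≡ s * q → p ≡ q
*-cancelˡ-invertible s i s*i≡1 {p} {q} s*p≡s*q = begin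
  p              ≡⟨ sym (*-inverse-cancelˡ i s i*s≡1 p) ⟩
  i * (s * p)    ≡⟨ cong (i *_) s*p≡s*q ⟩
  i * (s * q)    ≡⟨ *-inverse-cancelˡ i s i*s≡1 q ⟩
  q              ∎
  where
  open ≡-Reasoning
  i*s≡1 : i * s ≡ 1
  i*s≡1 = trans (ℚₚ.*-comm i s) s*i≡1

ℕ→ℚ-suc-inverse : ∀ c → ⟦ suc c ⟧ * (ℤ.+ 1 ℚ./ suc c) ≡ 1
ℕ→ℚ-suc-inverse c =
  trans (cong₂ _*_ (ℤ→ℚ≡fromℤ (ℤ.+ suc c)) (ℚₚ.normalize-coprime (coprime-sym (coprime-sym (1-coprimeTo (suc c))))))
        (ℚₚ.*-inverseʳ (ℚ.fromℤ (ℤ.+ suc c)))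

*-÷-suc : ∀ c r → ⟦ suc c ⟧ * (r * (ℤ.+ 1 ℚ./ suc c)) ≡ r
*-÷-suc c r = trans (cong (⟦ suc c ⟧ *_) (ℚₚ.*-comm r (ℤ.+ 1 ℚ./ suc c)))
                    (*-inverse-cancelˡ ⟦ suc c ⟧ (ℤ.+ 1 ℚ./ suc c) (ℕ→ℚ-suc-inverse c) r)

*-cancelˡ-suc : ∀ c {s p q} → s ≡ ⟦ suc c ⟧ → s * p ≡ s * q → p ≡ q
*-cancelˡ-suc c refl = *-cancelˡ-invertible ⟦ suc c ⟧ (ℤ.+ 1 ℚ./ suc c) (ℕ→ℚ-suc-inverse c)

x≡y+z⇒y≡x-z : ∀ {x y z} → x ≡ y + z → y ≡ x - z
x≡y+z⇒y≡x-z {x} {y} {z} refl = solve (y ∷ z ∷ []) ℚ-ring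

-- L ≡ R follows from A ≡ B when L − R = c (A − B) is a ring identity, the last argument.
linear-combination : ∀ {L R A B : ℚ} c → A ≡ B → L + c * B ≡ R + c * A → L ≡ R
linear-combination {L} {R} {A} {B} c A≡B eq = +-cancelʳ (c * B) L R (trans eq (cong (λ t → R + c * t) A≡B))

IsIntegral : ℚ → Set
IsIntegral p = ∃ λ (z : ℤ) → p ≡ ℤ→ℚ z

integral-cancelˡ : ∀ {p q} → IsIntegral p → IsIntegral (p + q) → IsIntegral q
integral-cancelˡ {p} {q} (z , p≡z) (w , p+q≡w) = w ℤ.- z , (begin
  q                     ≡⟨ solve (p ∷ q ∷ []) ℚ-ring ⟩
  (p + q) + - p         ≡⟨ cong₂ (λ u v → u + - v) p+q≡w p≡z ⟩
  ℤ→ℚ w + - ℤ→ℚ z       ≡⟨ sym (trans (ℤ→ℚ-+ w (ℤ.- z)) (cong (λ t → ℤ→ℚ w + t) (ℤ→ℚ-neg z))) ⟩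
  ℤ→ℚ (w ℤ.- z)         ∎)
  where open ≡-Reasoning

-- Reified ℕ-polynomials: the cast to ℚ is pushed through + and * in one step.
infixl 6 _‵+_
infixl 7 _‵*_
data Expr : Set where
  ‵_        : ℕ → Expr
  _‵+_ _‵*_ : Expr → Expr → Expr

evalℕ : Expr → ℕ
evalℕ (‵ n)   = n
evalℕ (e ‵+ f) = evalℕ e ℕ.+ evalℕ f
evalℕ (e ‵* f) = evalℕ e ℕ.* evalℕ f

evalℚ : Expr → ℚ
evalℚ (‵ n)   = ⟦ n ⟧
evalℚ (e ‵+ f) = evalℚ e + evalℚ f
evalℚ (e ‵* f) = evalℚ e * evalℚ f

ℕ→ℚ-evalℕ : ∀ e → ⟦ evalℕ e ⟧ ≡ evalℚ e
ℕ→ℚ-evalℕ (‵ n)   = refl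
ℕ→ℚ-evalℕ (e ‵+ f) = trans (ℕ→ℚ-+ (evalℕ e) (evalℕ f)) (cong₂ _+_ (ℕ→ℚ-evalℕ e) (ℕ→ℚ-evalℕ f))
ℕ→ℚ-evalℕ (e ‵* f) = trans (ℕ→ℚ-* (evalℕ e) (evalℕ f)) (cong₂ _*_ (ℕ→ℚ-evalℕ e) (ℕ→ℚ-evalℕ f))

ℕ→ℚ-via : ∀ {n} e → n ≡ evalℕ e → ⟦ n ⟧ ≡ evalℚ e
ℕ→ℚ-via e refl = ℕ→ℚ-evalℕ e

evalℚ-cong : ∀ e f → evalℕ e ≡ evalℕ f → evalℚ e ≡ evalℚ f
evalℚ-cong e f eq = trans (sym (ℕ→ℚ-evalℕ e)) (ℕ→ℚ-via f eq)

-- Newton series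

sumTo-cong : ∀ d {f g : ℕ → ℚ} → (∀ k → k ≤ d → f k ≡ g k) → sumTo d f ≡ sumTo d g
sumTo-cong zero    f≗g = f≗g 0 z≤n
sumTo-cong (suc d) f≗g =
  cong₂ _+_ (sumTo-cong d (λ k k≤d → f≗g k (ℕₚ.m≤n⇒m≤1+n k≤d))) (f≗g (suc d) ℕₚ.≤-refl)

sumTo-+ : ∀ d (f g : ℕ → ℚ) → sumTo d f + sumTo d g ≡ sumTo d (λ k → f k + g k)
sumTo-+ zero    f g = refl
sumTo-+ (suc d) f g =
  trans (+-interchange (sumTo d f) (f (suc d)) (sumTo d g) (g (suc d)))
        (cong (_+ (f (suc d) + g (suc d))) (sumTo-+ d f g))
  where
  +-interchange : ∀ a b c e → (a + b) + (c + e) ≡ (a + c) + (b + e)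
  +-interchange = solve-∀ ℚ-ring

sumTo-*ˡ : ∀ d c (f : ℕ → ℚ) → c * sumTo d f ≡ sumTo d (λ k → c * f k)
sumTo-*ˡ zero    c f = refl
sumTo-*ˡ (suc d) c f =
  trans (ℚₚ.*-distribˡ-+ c (sumTo d f) (f (suc d))) (cong (_+ c * f (suc d)) (sumTo-*ˡ d c f))

sumTo-peel : ∀ d (f : ℕ → ℚ) → sumTo (suc d) f ≡ f 0 + sumTo d (λ k → f (suc k))
sumTo-peel zero    f = refl
sumTo-peel (suc d) f =
  trans (cong (_+ f (suc (suc d))) (sumTo-peel d f)) (ℚₚ.+-assoc (f 0) _ (f (suc (suc d))))

sumTo-reverse : ∀ d (f : ℕ → ℚ) → sumTo d f ≡ sumTo d (λ k → f (d ∸ k))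
sumTo-reverse zero    f = refl
sumTo-reverse (suc d) f = begin
  sumTo d f + f (suc d)                             ≡⟨ cong (_+ f (suc d)) (sumTo-reverse d f) ⟩
  sumTo d (λ k → f (d ∸ k)) + f (suc d)             ≡⟨ ℚₚ.+-comm _ (f (suc d)) ⟩
  f (suc d) + sumTo d (λ k → f (d ∸ k))             ≡⟨ sym (sumTo-peel d (λ k → f (suc d ∸ k))) ⟩
  sumTo (suc d) (λ k → f (suc d ∸ k))               ∎
  where open ≡-Reasoning

newton : ℕ → (ℕ → ℚ) → ℕ → ℚ
newton d a x = sumTo d (λ k → a k * ⟦ x C k ⟧)

newton-cong : ∀ d {a b : ℕ → ℚ} x → (∀ k → k ≤ d → a k ≡ b k) → newton d a x ≡ newton d b x
newton-cong d x a≗b = sumTo-cong d (λ k k≤d → cong (_* ⟦ x C k ⟧) (a≗b k k≤d))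

newton-+ : ∀ d a b x → newton d a x + newton d b x ≡ newton d (λ k → a k + b k) x
newton-+ d a b x =
  trans (sumTo-+ d _ _) (sumTo-cong d (λ k _ → sym (ℚₚ.*-distribʳ-+ ⟦ x C k ⟧ (a k) (b k))))

newton-*ˡ : ∀ d c a x → c * newton d a x ≡ newton d (λ k → c * a k) x
newton-*ˡ d c a x = trans (sumTo-*ˡ d c _) (sumTo-cong d (λ k _ → sym (ℚₚ.*-assoc c (a k) ⟦ x C k ⟧)))

newton-at-0 : ∀ d a → newton d a 0 ≡ a 0
newton-at-0 zero    a = ℚₚ.*-identityʳ (a 0)
newton-at-0 (suc d) a =
  trans (cong₂ _+_ (newton-at-0 d a) (ℚₚ.*-zeroʳ (a (suc d)))) (ℚₚ.+-identityʳ (a 0))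

newton-Δ : ∀ d a x → newton (suc d) a (suc x) ≡ newton (suc d) a x + newton d (λ k → a (suc k)) x
newton-Δ d a x = begin
  newton (suc d) a (suc x)
    ≡⟨ sumTo-peel d _ ⟩
  a 0 * 1 + sumTo d (λ k → a (suc k) * ⟦ suc x C suc k ⟧)
    ≡⟨ cong (a 0 * 1 +_) (sumTo-cong d (λ k _ → pascal k)) ⟩
  a 0 * 1 + sumTo d (λ k → a (suc k) * ⟦ x C suc k ⟧ + a (suc k) * ⟦ x C k ⟧)
    ≡⟨ cong (a 0 * 1 +_) (sym (sumTo-+ d _ _)) ⟩
  a 0 * 1 + (sumTo d (λ k → a (suc k) * ⟦ x C suc k ⟧) + newton d (λ k → a (suc k)) x)
    ≡⟨ sym (ℚₚ.+-assoc (a 0 * 1) _ _) ⟩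
  (a 0 * 1 + sumTo d (λ k → a (suc k) * ⟦ x C suc k ⟧)) + newton d (λ k → a (suc k)) x
    ≡⟨ cong (_+ newton d (λ k → a (suc k)) x) (sym (sumTo-peel d _)) ⟩
  newton (suc d) a x + newton d (λ k → a (suc k)) x
    ∎
  where
  open ≡-Reasoning
  pascal : ∀ k → a (suc k) * ⟦ suc x C suc k ⟧ ≡ a (suc k) * ⟦ x C suc k ⟧ + a (suc k) * ⟦ x C k ⟧
  pascal k = begin
    a (suc k) * ⟦ suc x C suc k ⟧                   ≡⟨ cong (λ n → a (suc k) * ⟦ n ⟧) (sym (nCk+nC[k+1]≡[n+1]C[k+1] x k)) ⟩
    a (suc k) * ⟦ x C k ℕ.+ x C suc k ⟧             ≡⟨ cong (a (suc k) *_) (ℕ→ℚ-+ (x C k) (x C suc k)) ⟩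
    a (suc k) * (⟦ x C k ⟧ + ⟦ x C suc k ⟧)         ≡⟨ ℚₚ.*-distribˡ-+ (a (suc k)) _ _ ⟩
    a (suc k) * ⟦ x C k ⟧ + a (suc k) * ⟦ x C suc k ⟧ ≡⟨ ℚₚ.+-comm (a (suc k) * ⟦ x C k ⟧) _ ⟩
    a (suc k) * ⟦ x C suc k ⟧ + a (suc k) * ⟦ x C k ⟧ ∎

truncate : ℕ → (ℕ → ℚ) → ℕ → ℚ
truncate zero    b zero    = b zero
truncate zero    b (suc k) = 0ℚ
truncate (suc d) b zero    = b zero
truncate (suc d) b (suc k) = truncate d (λ j → b (suc j)) k

truncate-≤ : ∀ d b k → k ≤ d → truncate d b k ≡ b k
truncate-≤ zero    b zero    _           = refl
truncate-≤ (suc d) b zero    _           = refl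
truncate-≤ (suc d) b (suc k) (s≤s k≤d)   = truncate-≤ d (λ j → b (suc j)) k k≤d

truncate-suc : ∀ d b → truncate d b (suc d) ≡ 0ℚ
truncate-suc zero    b = refl
truncate-suc (suc d) b = truncate-suc d (λ j → b (suc j))

newton-truncate : ∀ d b x → newton d b x ≡ newton (suc d) (truncate d b) x
newton-truncate d b x = begin
  newton d b x                                          ≡⟨ sym (ℚₚ.+-identityʳ _) ⟩
  newton d b x + 0ℚ                                     ≡⟨ cong₂ _+_ (newton-cong d x (λ k k≤d → sym (truncate-≤ d b k k≤d))) top ⟩
  newton d (truncate d b) x + truncate d b (suc d) * ⟦ x C suc d ⟧ ∎
  where
  open ≡-Reasoning
  top : 0ℚ ≡ truncate d b (suc d) * ⟦ x C suc d ⟧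
  top = sym (trans (cong (_* ⟦ x C suc d ⟧) (truncate-suc d b)) (ℚₚ.*-zeroˡ ⟦ x C suc d ⟧))

Δcoeffs : ℕ → (ℕ → ℚ) → ℕ → ℚ
Δcoeffs zero    a k = 0ℚ
Δcoeffs (suc d) a k = truncate d (λ j → a (suc j)) k

Δcoeffs-< : ∀ d a k → k < d → Δcoeffs d a k ≡ a (suc k)
Δcoeffs-< (suc d) a k (s≤s k≤d) = truncate-≤ d (λ j → a (suc j)) k k≤d

Δcoeffs-top : ∀ d a → Δcoeffs d a d ≡ 0ℚ
Δcoeffs-top zero    a = refl
Δcoeffs-top (suc d) a = truncate-suc d (λ j → a (suc j))

newton-suc : ∀ d a x → newton d a (suc x) ≡ newton d (λ k → a k + Δcoeffs d a k) x
newton-suc zero    a x = cong (_* 1) (sym (ℚₚ.+-identityʳ (a 0)))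
newton-suc (suc d) a x = begin
  newton (suc d) a (suc x)                                                ≡⟨ newton-Δ d a x ⟩
  newton (suc d) a x + newton d (λ k → a (suc k)) x                       ≡⟨ cong (newton (suc d) a x +_) (newton-truncate d _ x) ⟩
  newton (suc d) a x + newton (suc d) (Δcoeffs (suc d) a) x               ≡⟨ newton-+ (suc d) a _ x ⟩
  newton (suc d) (λ k → a k + Δcoeffs (suc d) a k) x                      ∎
  where open ≡-Reasoning

prepend : ℚ → (ℕ → ℚ) → ℕ → ℚ
prepend c e zero    = c
prepend c e (suc k) = e k

newton-from-Δ : ∀ d (f : ℕ → ℚ) e → (∀ x → f (suc x) ≡ f x + newton d e x) →
                ∀ x → f x ≡ newton (suc d) (prepend (f 0) e) x
newton-from-Δ d f e Δf zero    = sym (newton-at-0 (suc d) (prepend (f 0) e))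
newton-from-Δ d f e Δf (suc x) = begin
  f (suc x)                                                  ≡⟨ Δf x ⟩
  f x + newton d e x                                         ≡⟨ cong (_+ newton d e x) (newton-from-Δ d f e Δf x) ⟩
  newton (suc d) (prepend (f 0) e) x + newton d e x          ≡⟨ sym (newton-Δ d (prepend (f 0) e) x) ⟩
  newton (suc d) (prepend (f 0) e) (suc x)                   ∎
  where open ≡-Reasoning

newton-injective : ∀ d a b → (∀ x → newton d a x ≡ newton d b x) → ∀ k → k ≤ d → a k ≡ b k
newton-injective d       a b a≗b zero    _         = trans (sym (newton-at-0 d a)) (trans (a≗b 0) (newton-at-0 d b))
newton-injective (suc d) a b a≗b (suc k) (s≤s k≤d) =
  newton-injective d (λ j → a (suc j)) (λ j → b (suc j)) Δa≗Δb k k≤d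
  where
  Δa≗Δb : ∀ x → newton d (λ j → a (suc j)) x ≡ newton d (λ j → b (suc j)) x
  Δa≗Δb x = +-cancelˡ (newton (suc d) a x) _ _ (begin
    newton (suc d) a x + newton d (λ j → a (suc j)) x   ≡⟨ sym (newton-Δ d a x) ⟩
    newton (suc d) a (suc x)                            ≡⟨ a≗b (suc x) ⟩
    newton (suc d) b (suc x)                            ≡⟨ newton-Δ d b x ⟩
    newton (suc d) b x + newton d (λ j → b (suc j)) x   ≡⟨ cong (_+ _) (sym (a≗b x)) ⟩
    newton (suc d) a x + newton d (λ j → b (suc j)) x   ∎)
    where open ≡-Reasoning

newton-integral : ∀ d a → (∀ x → IsIntegral (newton d a x)) → ∀ k → k ≤ d → IsIntegral (a k)
newton-integral d       a integral zero    _         = subst IsIntegral (newton-at-0 d a) (integral 0)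
newton-integral (suc d) a integral (suc k) (s≤s k≤d) =
  newton-integral d (λ j → a (suc j)) Δintegral k k≤d
  where
  Δintegral : ∀ x → IsIntegral (newton d (λ j → a (suc j)) x)
  Δintegral x = integral-cancelˡ (integral x) (subst IsIntegral (newton-Δ d a x) (integral (suc x)))

-- The products ℓ

prodUp-shift : ∀ m y → suc y ℕ.* prodUp m (suc y) ≡ (y ℕ.+ suc m) ℕ.* prodUp m y
prodUp-shift zero    y = cong (ℕ._* 1) (sym (ℕₚ.+-comm y 1))
prodUp-shift (suc m) y = begin
  suc y ℕ.* (prodUp m (suc y) ℕ.* (suc y ℕ.+ suc m))       ≡⟨ ℕₚ.*-assoc (suc y) (prodUp m (suc y)) (suc y ℕ.+ suc m) ⟨
  suc y ℕ.* prodUp m (suc y) ℕ.* (suc y ℕ.+ suc m)         ≡⟨ cong (ℕ._* (suc y ℕ.+ suc m)) (prodUp-shift m y) ⟩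
  (y ℕ.+ suc m) ℕ.* prodUp m y ℕ.* (suc y ℕ.+ suc m)       ≡⟨ rearrange y m (prodUp m y) ⟩
  (y ℕ.+ suc (suc m)) ℕ.* (prodUp m y ℕ.* (y ℕ.+ suc m))   ∎
  where
  open ≡-Reasoning
  rearrange : ∀ y m p → (y ℕ.+ suc m) ℕ.* p ℕ.* (suc y ℕ.+ suc m) ≡ (y ℕ.+ suc (suc m)) ℕ.* (p ℕ.* (y ℕ.+ suc m))
  rearrange = ℕ-Solver.solve-∀

prodUp-Δ : ∀ m x → prodUp (suc m) (suc x) ≡ prodUp (suc m) x ℕ.+ suc m ℕ.* prodUp m (suc x)
prodUp-Δ m x = begin
  prodUp m (suc x) ℕ.* (suc x ℕ.+ suc m)                         ≡⟨ split (prodUp m (suc x)) x m ⟩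
  suc x ℕ.* prodUp m (suc x) ℕ.+ suc m ℕ.* prodUp m (suc x)       ≡⟨ cong (ℕ._+ suc m ℕ.* prodUp m (suc x)) (prodUp-shift m x) ⟩
  (x ℕ.+ suc m) ℕ.* prodUp m x ℕ.+ suc m ℕ.* prodUp m (suc x)     ≡⟨ cong (ℕ._+ suc m ℕ.* prodUp m (suc x)) (ℕₚ.*-comm (x ℕ.+ suc m) _) ⟩
  prodUp m x ℕ.* (x ℕ.+ suc m) ℕ.+ suc m ℕ.* prodUp m (suc x)     ∎
  where
  open ≡-Reasoning
  split : ∀ p x m → p ℕ.* (suc x ℕ.+ suc m) ≡ suc x ℕ.* p ℕ.+ suc m ℕ.* p
  split = ℕ-Solver.solve-∀

prodUp-0 : ∀ m → prodUp m 0 ≡ m !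
prodUp-0 zero    = refl
prodUp-0 (suc m) = trans (cong (ℕ._* suc m) (prodUp-0 m)) (ℕₚ.*-comm (m !) (suc m))

ℓ-coeff : ℕ → ℕ → ℚ
ℓ-coeff d k = ⟦ d ! ℕ.* (d C k) ⟧

Δcoeffs-ℓ-coeff : ∀ d k → k ≤ d → Δcoeffs d (ℓ-coeff d) k ≡ ℓ-coeff d (suc k)
Δcoeffs-ℓ-coeff d k k≤d with ℕₚ.m≤n⇒m<n∨m≡n k≤d
... | inj₁ k<d  = Δcoeffs-< d (ℓ-coeff d) k k<d
... | inj₂ refl = trans (Δcoeffs-top k (ℓ-coeff k))
                        (cong ⟦_⟧ (sym (trans (cong (k ! ℕ.*_) (k>n⇒nCk≡0 (ℕₚ.n<1+n k))) (ℕₚ.*-zeroʳ (k !)))))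

prodUp-newton : ∀ d x → ⟦ prodUp d x ⟧ ≡ newton d (ℓ-coeff d) x
prodUp-newton zero    x = refl
prodUp-newton (suc d) x =
  trans (newton-from-Δ d (λ y → ⟦ prodUp (suc d) y ⟧) Δ-coeff Δ-prodUp x) (newton-cong (suc d) x coeffs)
  where
  Δ-coeff : ℕ → ℚ
  Δ-coeff k = ⟦ suc d ⟧ * (ℓ-coeff d k + Δcoeffs d (ℓ-coeff d) k)
  Δ-prodUp : ∀ y → ⟦ prodUp (suc d) (suc y) ⟧ ≡ ⟦ prodUp (suc d) y ⟧ + newton d Δ-coeff y
  Δ-prodUp y = begin
    ⟦ prodUp (suc d) (suc y) ⟧
      ≡⟨ cong ⟦_⟧ (prodUp-Δ d y) ⟩
    ⟦ prodUp (suc d) y ℕ.+ suc d ℕ.* prodUp d (suc y) ⟧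
      ≡⟨ ℕ→ℚ-via (‵ prodUp (suc d) y ‵+ ‵ suc d ‵* ‵ prodUp d (suc y)) refl ⟩
    ⟦ prodUp (suc d) y ⟧ + ⟦ suc d ⟧ * ⟦ prodUp d (suc y) ⟧
      ≡⟨ cong (λ t → ⟦ prodUp (suc d) y ⟧ + ⟦ suc d ⟧ * t) (trans (prodUp-newton d (suc y)) (newton-suc d (ℓ-coeff d) y)) ⟩
    ⟦ prodUp (suc d) y ⟧ + ⟦ suc d ⟧ * newton d (λ k → ℓ-coeff d k + Δcoeffs d (ℓ-coeff d) k) y
      ≡⟨ cong (⟦ prodUp (suc d) y ⟧ +_) (newton-*ˡ d ⟦ suc d ⟧ _ y) ⟩
    ⟦ prodUp (suc d) y ⟧ + newton d Δ-coeff y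
      ∎
    where open ≡-Reasoning
  coeffs : ∀ k → k ≤ suc d → prepend ⟦ prodUp (suc d) 0 ⟧ Δ-coeff k ≡ ℓ-coeff (suc d) k
  coeffs zero    _         = cong ⟦_⟧ (trans (prodUp-0 (suc d)) (sym (ℕₚ.*-identityʳ (suc d !))))
  coeffs (suc k) (s≤s k≤d) = begin
    ⟦ suc d ⟧ * (ℓ-coeff d k + Δcoeffs d (ℓ-coeff d) k)
      ≡⟨ cong (λ t → ⟦ suc d ⟧ * (ℓ-coeff d k + t)) (Δcoeffs-ℓ-coeff d k k≤d) ⟩
    ⟦ suc d ⟧ * (⟦ d ! ℕ.* (d C k) ⟧ + ⟦ d ! ℕ.* (d C suc k) ⟧)
      ≡⟨ sym (ℕ→ℚ-via (‵ suc d ‵* (‵ (d ! ℕ.* (d C k)) ‵+ ‵ (d ! ℕ.* (d C suc k)))) refl) ⟩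
    ⟦ suc d ℕ.* (d ! ℕ.* (d C k) ℕ.+ d ! ℕ.* (d C suc k)) ⟧
      ≡⟨ cong ⟦_⟧ (trans (factor (suc d) (d !) (d C k) (d C suc k)) (cong (suc d ℕ.* d ! ℕ.*_) (nCk+nC[k+1]≡[n+1]C[k+1] d k))) ⟩
    ⟦ suc d ! ℕ.* (suc d C suc k) ⟧
      ∎
    where
    open ≡-Reasoning
    factor : ∀ a b u v → a ℕ.* (b ℕ.* u ℕ.+ b ℕ.* v) ≡ a ℕ.* b ℕ.* (u ℕ.+ v)
    factor = ℕ-Solver.solve-∀

isOdd-+2 : ∀ n → isOdd (suc (suc n)) ≡ isOdd n
isOdd-+2 n with isOdd n
... | true  = refl
... | false = refl

isOdd-*2 : ∀ m → isOdd (m ℕ.* 2) ≡ false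
isOdd-*2 zero    = refl
isOdd-*2 (suc m) = trans (isOdd-+2 (m ℕ.* 2)) (isOdd-*2 m)

isOdd-1+*2 : ∀ m → isOdd (suc (m ℕ.* 2)) ≡ true
isOdd-1+*2 zero    = refl
isOdd-1+*2 (suc m) = trans (isOdd-+2 (suc (m ℕ.* 2))) (isOdd-1+*2 m)

even-or-odd : ∀ n → (∃ λ m → n ≡ m ℕ.* 2) ⊎ (∃ λ m → n ≡ suc (m ℕ.* 2))
even-or-odd zero          = inj₁ (0 , refl)
even-or-odd (suc zero)    = inj₂ (0 , refl)
even-or-odd (suc (suc n)) with even-or-odd n
... | inj₁ (m , refl) = inj₁ (suc m , refl)
... | inj₂ (m , refl) = inj₂ (suc m , refl)

isOdd⇒1+*2 : ∀ {n} → isOdd n ≡ true → ∃ λ m → n ≡ suc (m ℕ.* 2)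
isOdd⇒1+*2 {n} odd with even-or-odd n
... | inj₂ n≡1+2m = n≡1+2m
... | inj₁ (m , refl) with trans (sym odd) (isOdd-*2 m)
... | ()

¬isOdd⇒*2 : ∀ {n} → isOdd n ≡ false → ∃ λ m → n ≡ m ℕ.* 2
¬isOdd⇒*2 {n} even with even-or-odd n
... | inj₁ n≡2m = n≡2m
... | inj₂ (m , refl) with trans (sym even) (isOdd-1+*2 m)
... | ()

deg-1+*2 : ∀ m → deg (suc (m ℕ.* 2)) ≡ m
deg-1+*2 m = m*n/n≡m m 2

deg-2+*2 : ∀ m → deg (suc (suc (m ℕ.* 2))) ≡ m
deg-2+*2 m = trans (+-distrib-/-∣ʳ 1 {d = 2} (divides-refl m)) (m*n/n≡m m 2)

-- Recurrences for P

if-true : ∀ {A : Set} {b} {x y : A} → b ≡ true → (if b then x else y) ≡ x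
if-true refl = refl

if-false : ∀ {A : Set} {b} {x y : A} → b ≡ false → (if b then x else y) ≡ y
if-false refl = refl

Pₒ Pₑ : ℕ → ℕ → ℚ
Pₒ m = P (suc (m ℕ.* 2))
Pₑ m = P (suc (suc (m ℕ.* 2)))

ℓ : ℕ → ℕ → ℚ
ℓ m x = ⟦ prodUp m x ⟧

ell-1+*2 : ∀ m x → ell (suc (m ℕ.* 2)) x ≡ prodUp m x
ell-1+*2 m x = cong (λ t → prodUp t x) (deg-1+*2 m)

ℓ-shift : ∀ m y → (1 + ⟦ y ⟧) * ℓ m (suc y) ≡ (⟦ y ⟧ + (1 + ⟦ m ⟧)) * ℓ m y
ℓ-shift m y =
  evalℚ-cong ((‵ 1 ‵+ ‵ y) ‵* ‵ prodUp m (suc y)) ((‵ y ‵+ (‵ 1 ‵+ ‵ m)) ‵* ‵ prodUp m y) (prodUp-shift m y)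

ℓ-suc : ∀ m y → ℓ (suc m) y ≡ ℓ m y * (⟦ y ⟧ + (1 + ⟦ m ⟧))
ℓ-suc m y = ℕ→ℚ-evalℕ (‵ prodUp m y ‵* (‵ y ‵+ (‵ 1 ‵+ ‵ m)))

ℓ-Δ : ∀ m x → ℓ (suc m) (suc x) ≡ ℓ (suc m) x + (1 + ⟦ m ⟧) * ℓ m (suc x)
ℓ-Δ m x = ℕ→ℚ-via (‵ prodUp (suc m) x ‵+ (‵ 1 ‵+ ‵ m) ‵* ‵ prodUp m (suc x)) (prodUp-Δ m x)

-- The defining recurrences of P_{2m+4} and P_{2m+3}, denominators cleared.
Pₑ-suc : ∀ m x →
  (1 + (8 * ⟦ x ⟧ + 4 * (1 + ⟦ m ⟧ * 2) + 7)) * Pₑ (suc m) x ≡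
  2 * (⟦ x ⟧ + (3 + ⟦ m ⟧ * 2)) * Pₒ (suc m) x + (2 * ⟦ x ⟧ + (3 + ⟦ m ⟧ * 2)) * Pₒ (suc m) (suc x)
    + (4 * ⟦ x ⟧ + (3 + ⟦ m ⟧ * 2)) * ℓ (suc m) x
Pₑ-suc m x =
  trans (cong₂ _*_ (sym (ℕ→ℚ-evalℕ (‵ 1 ‵+ (‵ 8 ‵* ‵ x ‵+ ‵ 4 ‵* (‵ 1 ‵+ ‵ m ‵* ‵ 2) ‵+ ‵ 7))))
                   (if-true (isOdd-1+*2 (suc m))))
  (trans (*-÷-suc (8 ℕ.* x ℕ.+ 4 ℕ.* suc (m ℕ.* 2) ℕ.+ 7) _)
    (cong₂ _+_
      (cong₂ _+_ (cong (_* Pₒ (suc m) x) (ℕ→ℚ-evalℕ (‵ 2 ‵* (‵ x ‵+ (‵ 3 ‵+ ‵ m ‵* ‵ 2)))))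
                 (cong (_* Pₒ (suc m) (suc x)) (ℕ→ℚ-evalℕ (‵ 2 ‵* ‵ x ‵+ (‵ 3 ‵+ ‵ m ‵* ‵ 2)))))
      (cong₂ _*_ (ℕ→ℚ-evalℕ (‵ 4 ‵* ‵ x ‵+ (‵ 3 ‵+ ‵ m ‵* ‵ 2))) (cong ⟦_⟧ (ell-1+*2 (suc m) x)))))

Pₒ-suc : ∀ m x →
  4 * Pₒ (suc m) x ≡
  4 * (⟦ x ⟧ + (2 + ⟦ m ⟧ * 2)) * Pₑ m x + 2 * (2 * ⟦ x ⟧ + (2 + ⟦ m ⟧ * 2) + 1) * Pₑ m (suc x)
    + (4 * ⟦ x ⟧ + (2 + ⟦ m ⟧ * 2)) * ℓ m x
Pₒ-suc m x =
  trans (cong (4 *_) (if-false (isOdd-*2 (suc m))))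
  (trans (*-÷-suc 3 _)
    (cong₂ _+_
      (cong₂ _+_ (cong (_* Pₑ m x) (ℕ→ℚ-evalℕ (‵ 4 ‵* (‵ x ‵+ (‵ 2 ‵+ ‵ m ‵* ‵ 2)))))
                 (cong (_* Pₑ m (suc x)) (ℕ→ℚ-evalℕ (‵ 2 ‵* (‵ 2 ‵* ‵ x ‵+ (‵ 2 ‵+ ‵ m ‵* ‵ 2) ‵+ ‵ 1)))))
      (cong₂ _*_ (ℕ→ℚ-evalℕ (‵ 4 ‵* ‵ x ‵+ (‵ 2 ‵+ ‵ m ‵* ‵ 2))) (cong ⟦_⟧ (ell-1+*2 m x)))))

EvenFromOdd OddShift EvenShift OddFromEven : ℕ → Set
EvenFromOdd m = ∀ x → 2 * Pₑ m x ≡ Pₒ m (suc x) + ℓ m x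
OddShift    m = ∀ x → (2 * ⟦ x ⟧ + 2 * ⟦ m ⟧ + 1) * Pₒ m (suc x) + (2 * ⟦ m ⟧ + 1) * ℓ m x
                      ≡ 2 * (⟦ x ⟧ + 2 * ⟦ m ⟧ + 1) * Pₒ m x
EvenShift   m = ∀ x → (2 * ⟦ x ⟧ + 2 * ⟦ m ⟧ + 3) * Pₑ m (suc x) + (⟦ m ⟧ + 1) * ℓ m x
                      ≡ 2 * (⟦ x ⟧ + 2 * ⟦ m ⟧ + 2) * Pₑ m x
OddFromEven m = ∀ x → Pₒ (suc m) x ≡ ℓ (suc m) x + (2 * ⟦ x ⟧ + 2 * ⟦ m ⟧ + 3) * Pₑ m (suc x)

oddShift-0 : OddShift 0
oddShift-0 x = identity ⟦ x ⟧
  where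
  identity : ∀ X → (2 * X + 2 * 0 + 1) * 1 + (2 * 0 + 1) * 1 ≡ 2 * (X + 2 * 0 + 1) * 1
  identity = solve-∀ ℚ-ring

evenShift-algebra : ∀ Y Y′ M q₀ q₁ a₁ a₂ l₀ l₁ → Y′ ≡ 1 + Y →
  a₁ ≡ 2 * q₀ - l₀ → a₂ ≡ 2 * q₁ - l₁ →
  (2 * Y′ + 2 * M + 1) * a₂ + (2 * M + 1) * l₁ ≡ 2 * (Y′ + 2 * M + 1) * a₁ →
  (1 + Y) * l₁ ≡ (Y + (1 + M)) * l₀ →
  2 * ((2 * Y + 2 * M + 3) * q₁ + (M + 1) * l₀) ≡ 2 * (2 * (Y + 2 * M + 2) * q₀)
evenShift-algebra Y _ M q₀ q₁ _ _ l₀ l₁ refl refl refl F L =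
  linear-combination 1 F (linear-combination 2 L (solve (Y ∷ M ∷ q₀ ∷ q₁ ∷ l₀ ∷ l₁ ∷ []) ℚ-ring))

evenShift-from : ∀ m → EvenFromOdd m → OddShift m → EvenShift m
evenShift-from m E F y = *-cancelˡ-suc 1 refl
  (evenShift-algebra ⟦ y ⟧ ⟦ suc y ⟧ ⟦ m ⟧ (Pₑ m y) (Pₑ m (suc y)) (Pₒ m (suc y)) (Pₒ m (suc (suc y)))
      (ℓ m y) (ℓ m (suc y)) (ℕ→ℚ-suc y)
    (x≡y+z⇒y≡x-z (E y)) (x≡y+z⇒y≡x-z (E (suc y))) (F (suc y)) (ℓ-shift m y))

oddFromEven-algebra : ∀ X M q₀ q₁ l l′ → l′ ≡ l * (X + (1 + M)) →
  (2 * X + 2 * M + 3) * q₁ + (M + 1) * l ≡ 2 * (X + 2 * M + 2) * q₀ →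
  4 * (X + (2 + M * 2)) * q₀ + 2 * (2 * X + (2 + M * 2) + 1) * q₁ + (4 * X + (2 + M * 2)) * l
    ≡ 4 * (l′ + (2 * X + 2 * M + 3) * q₁)
oddFromEven-algebra X M q₀ q₁ l _ refl G =
  linear-combination (- 2) G (solve (X ∷ M ∷ q₀ ∷ q₁ ∷ l ∷ []) ℚ-ring)

oddFromEven-from : ∀ m → EvenShift m → OddFromEven m
oddFromEven-from m G x = *-cancelˡ-suc 3 refl
  (trans (Pₒ-suc m x)
    (oddFromEven-algebra ⟦ x ⟧ ⟦ m ⟧ (Pₑ m x) (Pₑ m (suc x)) (ℓ m x) (ℓ (suc m) x) (ℓ-suc m x) (G x)))

Pₒ-Δ-algebra : ∀ X X′ M q₁ q₂ l₀ l₁ ls a₀ a₁ → X′ ≡ 1 + X →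
  l₁ ≡ l₀ + (1 + M) * ls →
  a₀ ≡ l₀ + (2 * X + 2 * M + 3) * q₁ →
  a₁ ≡ l₁ + (2 * X′ + 2 * M + 3) * q₂ →
  (2 * X′ + 2 * M + 3) * q₂ + (M + 1) * ls ≡ 2 * (X′ + 2 * M + 2) * q₁ →
  a₁ ≡ a₀ + (3 + M * 2) * q₁
Pₒ-Δ-algebra X _ M q₁ q₂ l₀ _ ls _ _ refl refl refl refl G =
  linear-combination 1 G (solve (X ∷ M ∷ q₁ ∷ q₂ ∷ l₀ ∷ ls ∷ []) ℚ-ring)

Pₒ-Δ-from : ∀ m → OddFromEven m → EvenShift m →
            ∀ x → Pₒ (suc m) (suc x) ≡ Pₒ (suc m) x + (3 + ⟦ m ⟧ * 2) * Pₑ m (suc x)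
Pₒ-Δ-from m I G x =
  Pₒ-Δ-algebra ⟦ x ⟧ ⟦ suc x ⟧ ⟦ m ⟧ (Pₑ m (suc x)) (Pₑ m (suc (suc x))) (ℓ (suc m) x) (ℓ (suc m) (suc x))
    (ℓ m (suc x)) (Pₒ (suc m) x) (Pₒ (suc m) (suc x)) (ℕ→ℚ-suc x) (ℓ-Δ m x) (I x) (I (suc x)) (G (suc x))

oddShift-algebra : ∀ X M M′ q l a₀ a₁ → M′ ≡ 1 + M →
  a₀ ≡ l + (2 * X + 2 * M + 3) * q → a₁ ≡ a₀ + (3 + M * 2) * q →
  (2 * X + 2 * M′ + 1) * a₁ + (2 * M′ + 1) * l ≡ 2 * (X + 2 * M′ + 1) * a₀
oddShift-algebra X M _ q l _ _ refl refl refl = solve (X ∷ M ∷ q ∷ l ∷ []) ℚ-ring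

oddShift-step : ∀ m → OddFromEven m → EvenShift m → OddShift (suc m)
oddShift-step m I G x =
  oddShift-algebra ⟦ x ⟧ ⟦ m ⟧ ⟦ suc m ⟧ (Pₑ m (suc x)) (ℓ (suc m) x) (Pₒ (suc m) x) (Pₒ (suc m) (suc x))
    (ℕ→ℚ-suc m) (I x) (Pₒ-Δ-from m I G x)

evenFromOdd-algebra : ∀ X M M′ q a₀ a₁ l → M′ ≡ 1 + M →
  (1 + (8 * X + 4 * (1 + M * 2) + 7)) * q
    ≡ 2 * (X + (3 + M * 2)) * a₀ + (2 * X + (3 + M * 2)) * a₁ + (4 * X + (3 + M * 2)) * l →
  (2 * X + 2 * M′ + 1) * a₁ + (2 * M′ + 1) * l ≡ 2 * (X + 2 * M′ + 1) * a₀ →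
  (1 + (8 * X + 4 * (1 + M * 2) + 7)) * (2 * q) ≡ (1 + (8 * X + 4 * (1 + M * 2) + 7)) * (a₁ + l)
evenFromOdd-algebra X M _ q a₀ a₁ l refl Q F =
  linear-combination 2 Q (linear-combination (- 2) F (solve (X ∷ M ∷ q ∷ a₀ ∷ a₁ ∷ l ∷ []) ℚ-ring))

evenFromOdd-step : ∀ m → OddShift (suc m) → EvenFromOdd (suc m)
evenFromOdd-step m F x =
  *-cancelˡ-suc (8 ℕ.* x ℕ.+ 4 ℕ.* suc (m ℕ.* 2) ℕ.+ 7)
    (sym (ℕ→ℚ-evalℕ (‵ 1 ‵+ (‵ 8 ‵* ‵ x ‵+ ‵ 4 ‵* (‵ 1 ‵+ ‵ m ‵* ‵ 2) ‵+ ‵ 7))))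
    (evenFromOdd-algebra ⟦ x ⟧ ⟦ m ⟧ ⟦ suc m ⟧ (Pₑ (suc m) x) (Pₒ (suc m) x) (Pₒ (suc m) (suc x)) (ℓ (suc m) x)
      (ℕ→ℚ-suc m) (Pₑ-suc m x) (F x))

odd-and-even-recurrences : ∀ m → OddShift m × EvenFromOdd m
odd-and-even-recurrences zero    = oddShift-0 , (λ x → refl)
odd-and-even-recurrences (suc m) = F′ , evenFromOdd-step m F′
  where
  G : EvenShift m
  G = evenShift-from m (proj₂ (odd-and-even-recurrences m)) (proj₁ (odd-and-even-recurrences m))
  F′ : OddShift (suc m)
  F′ = oddShift-step m (oddFromEven-from m G) G

oddShift : ∀ m → OddShift m
oddShift m = proj₁ (odd-and-even-recurrences m)

evenFromOdd : ∀ m → EvenFromOdd m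
evenFromOdd m = proj₂ (odd-and-even-recurrences m)

evenShift : ∀ m → EvenShift m
evenShift m = evenShift-from m (evenFromOdd m) (oddShift m)

oddFromEven : ∀ m → OddFromEven m
oddFromEven m = oddFromEven-from m (evenShift m)

Pₒ-Δ : ∀ m x → Pₒ (suc m) (suc x) ≡ Pₒ (suc m) x + (3 + ⟦ m ⟧ * 2) * Pₑ m (suc x)
Pₒ-Δ m = Pₒ-Δ-from m (oddFromEven m) (evenShift m)

-- Integrality

IsNatural : ℚ → Set
IsNatural p = ∃ λ (k : ℕ) → p ≡ ⟦ k ⟧

Pₑ-0-algebra : ∀ M q a₀ a₁ l →
  (2 * 0 + 2 * M + 1) * a₁ + (2 * M + 1) * l ≡ 2 * (0 + 2 * M + 1) * a₀ → 2 * q ≡ a₁ + l →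
  (1 + M * 2) * (2 * q) ≡ (1 + M * 2) * (2 * a₀)
Pₑ-0-algebra M q a₀ a₁ l F E =
  linear-combination 1 F (linear-combination (1 + M * 2) E (solve (M ∷ q ∷ a₀ ∷ a₁ ∷ l ∷ []) ℚ-ring))

Pₑ-0 : ∀ m → Pₑ m 0 ≡ Pₒ m 0
Pₑ-0 m = *-cancelˡ-suc 1 refl (*-cancelˡ-suc (m ℕ.* 2) (sym (ℕ→ℚ-evalℕ (‵ 1 ‵+ ‵ m ‵* ‵ 2)))
  (Pₑ-0-algebra ⟦ m ⟧ (Pₑ m 0) (Pₒ m 0) (Pₒ m 1) (ℓ m 0) (oddShift m 0) (evenFromOdd m 0)))

[1+2k]n+2a≡2b⇒2∣n : ∀ k n a b → (1 ℕ.+ 2 ℕ.* k) ℕ.* n ℕ.+ 2 ℕ.* a ≡ 2 ℕ.* b → 2 ∣ n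
[1+2k]n+2a≡2b⇒2∣n k n a b eq =
  ∣m+n∣m⇒∣n (subst (2 ∣_) (trans (sym eq) (regroup k n a)) (m∣m*n b)) (m∣m*n (k ℕ.* n ℕ.+ a))
  where
  regroup : ∀ k n a → (1 ℕ.+ 2 ℕ.* k) ℕ.* n ℕ.+ 2 ℕ.* a ≡ 2 ℕ.* (k ℕ.* n ℕ.+ a) ℕ.+ n
  regroup = ℕ-Solver.solve-∀

Pₑ-parity-algebra : ∀ Y M q₀ q₁ l W → 2 * q₁ ≡ W →
  (2 * Y + 2 * M + 3) * q₁ + (M + 1) * l ≡ 2 * (Y + 2 * M + 2) * q₀ →
  (1 + 2 * (Y + M + 1)) * W + 2 * ((M + 1) * l) ≡ 2 * (2 * (Y + 2 * M + 2) * q₀)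
Pₑ-parity-algebra Y M q₀ q₁ l _ refl G =
  linear-combination 2 G (solve (Y ∷ M ∷ q₀ ∷ q₁ ∷ l ∷ []) ℚ-ring)

half-of-even : ∀ {p n} → 2 * p ≡ ⟦ n ⟧ → 2 ∣ n → IsNatural p
half-of-even 2p≡2h (divides h refl) =
  h , *-cancelˡ-suc 1 {2} refl (trans 2p≡2h (ℕ→ℚ-via (‵ 2 ‵* ‵ h) (ℕₚ.*-comm h 2)))

Pₑ-natural-suc : ∀ m y → IsNatural (Pₒ m (suc (suc y))) → IsNatural (Pₑ m y) → IsNatural (Pₑ m (suc y))
Pₑ-natural-suc m y (w , Pₒ≡w) (z , Pₑ≡z) = half-of-even twice≡W W-even
  where
  twice≡W : 2 * Pₑ m (suc y) ≡ ⟦ w ℕ.+ prodUp m (suc y) ⟧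
  twice≡W = trans (evenFromOdd m (suc y))
                  (trans (cong (_+ ℓ m (suc y)) Pₒ≡w) (sym (ℕ→ℚ-+ w (prodUp m (suc y)))))
  lhs rhs : Expr
  lhs = (‵ 1 ‵+ ‵ 2 ‵* (‵ y ‵+ ‵ m ‵+ ‵ 1)) ‵* ‵ (w ℕ.+ prodUp m (suc y)) ‵+ ‵ 2 ‵* ((‵ m ‵+ ‵ 1) ‵* ‵ prodUp m y)
  rhs = ‵ 2 ‵* (‵ 2 ‵* (‵ y ‵+ ‵ 2 ‵* ‵ m ‵+ ‵ 2) ‵* ‵ z)
  parity : evalℚ lhs ≡ 2 * (2 * (⟦ y ⟧ + 2 * ⟦ m ⟧ + 2) * Pₑ m y)
  parity = Pₑ-parity-algebra ⟦ y ⟧ ⟦ m ⟧ (Pₑ m y) (Pₑ m (suc y)) (ℓ m y) ⟦ w ℕ.+ prodUp m (suc y) ⟧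
                             twice≡W (evenShift m y)
  W-even : 2 ∣ w ℕ.+ prodUp m (suc y)
  W-even = [1+2k]n+2a≡2b⇒2∣n (y ℕ.+ m ℕ.+ 1) (w ℕ.+ prodUp m (suc y)) ((m ℕ.+ 1) ℕ.* prodUp m y)
                                (2 ℕ.* (y ℕ.+ 2 ℕ.* m ℕ.+ 2) ℕ.* z) (ℕ→ℚ-injective {evalℕ lhs} {evalℕ rhs}
    (trans (ℕ→ℚ-evalℕ lhs) (trans parity
    (trans (cong (λ t → 2 * (2 * (⟦ y ⟧ + 2 * ⟦ m ⟧ + 2) * t)) Pₑ≡z) (sym (ℕ→ℚ-evalℕ rhs))))))

Pₑ-natural : ∀ m → (∀ x → IsNatural (Pₒ m x)) → ∀ y → IsNatural (Pₑ m y)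
Pₑ-natural m odd-natural zero    = subst IsNatural (sym (Pₑ-0 m)) (odd-natural 0)
Pₑ-natural m odd-natural (suc y) = Pₑ-natural-suc m y (odd-natural (suc (suc y))) (Pₑ-natural m odd-natural y)

Pₒ-natural-suc : ∀ m x → IsNatural (Pₑ m (suc x)) → IsNatural (Pₒ (suc m) x)
Pₒ-natural-suc m x (k , Pₑ≡k) = evalℕ value , trans Pₒ≡value (sym (ℕ→ℚ-evalℕ value))
  where
  value : Expr
  value = ‵ prodUp (suc m) x ‵+ (‵ 2 ‵* ‵ x ‵+ ‵ 2 ‵* ‵ m ‵+ ‵ 3) ‵* ‵ k
  Pₒ≡value : Pₒ (suc m) x ≡ evalℚ value
  Pₒ≡value = trans (oddFromEven m x) (cong (λ t → ℓ (suc m) x + (2 * ⟦ x ⟧ + 2 * ⟦ m ⟧ + 3) * t) Pₑ≡k)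

Pₒ-natural : ∀ m x → IsNatural (Pₒ m x)
Pₒ-natural zero    x = 1 , refl
Pₒ-natural (suc m) x = Pₒ-natural-suc m x (Pₑ-natural m (Pₒ-natural m) (suc x))

-- Newton coefficients of P

Pₒ-newton-Δ : ∀ m a → (∀ x → Pₒ (suc m) x ≡ newton (suc m) a x) →
              ∀ x → newton m (λ k → a (suc k)) x ≡ ⟦ suc (suc m ℕ.* 2) ⟧ * Pₑ m (suc x)
Pₒ-newton-Δ m a rep x =
  +-cancelˡ (newton (suc m) a x) (newton m (λ k → a (suc k)) x) (⟦ suc (suc m ℕ.* 2) ⟧ * Pₑ m (suc x)) (begin
  newton (suc m) a x + newton m (λ k → a (suc k)) x      ≡⟨ sym (newton-Δ m a x) ⟩
  newton (suc m) a (suc x)                               ≡⟨ sym (rep (suc x)) ⟩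
  Pₒ (suc m) (suc x)                                     ≡⟨ Pₒ-Δ m x ⟩
  Pₒ (suc m) x + (3 + ⟦ m ⟧ * 2) * Pₑ m (suc x)
    ≡⟨ cong₂ (λ u c → u + c * Pₑ m (suc x)) (rep x) (sym (ℕ→ℚ-evalℕ (‵ 3 ‵+ ‵ m ‵* ‵ 2))) ⟩
  newton (suc m) a x + ⟦ suc (suc m ℕ.* 2) ⟧ * Pₑ m (suc x) ∎)
  where open ≡-Reasoning

Pₒ-coeffs-divisible : ∀ m a → (∀ x → Pₒ (suc m) x ≡ newton (suc m) a x) →
  ∀ k → k ≤ m → ∃ λ z → a (suc k) ≡ ⟦ suc (suc m ℕ.* 2) ⟧ * ℤ→ℚ z
Pₒ-coeffs-divisible m a rep k k≤m =
  proj₁ c-integral-at-k ,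
  trans (sym (*-inverse-cancelˡ ⟦ suc (suc m ℕ.* 2) ⟧ n⁻¹ n*n⁻¹≡1 (a (suc k))))
        (cong (⟦ suc (suc m ℕ.* 2) ⟧ *_) (proj₂ c-integral-at-k))
  where
  n⁻¹ : ℚ
  n⁻¹ = ℤ.+ 1 ℚ./ suc (suc m ℕ.* 2)
  n*n⁻¹≡1 : ⟦ suc (suc m ℕ.* 2) ⟧ * n⁻¹ ≡ 1
  n*n⁻¹≡1 = ℕ→ℚ-suc-inverse (suc m ℕ.* 2)
  n⁻¹*n≡1 : n⁻¹ * ⟦ suc (suc m ℕ.* 2) ⟧ ≡ 1
  n⁻¹*n≡1 = trans (ℚₚ.*-comm n⁻¹ ⟦ suc (suc m ℕ.* 2) ⟧) n*n⁻¹≡1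
  c : ℕ → ℚ
  c k = n⁻¹ * a (suc k)
  c-integral : ∀ x → IsIntegral (newton m c x)
  c-integral x = from-natural (Pₑ-natural m (Pₒ-natural m) (suc x))
    where
    open ≡-Reasoning
    from-natural : IsNatural (Pₑ m (suc x)) → IsIntegral (newton m c x)
    from-natural (j , Pₑ≡j) = ℤ.+ j , (begin
      newton m c x                                   ≡⟨ sym (newton-*ˡ m n⁻¹ (λ k → a (suc k)) x) ⟩
      n⁻¹ * newton m (λ k → a (suc k)) x             ≡⟨ cong (n⁻¹ *_) (Pₒ-newton-Δ m a rep x) ⟩
      n⁻¹ * (⟦ suc (suc m ℕ.* 2) ⟧ * Pₑ m (suc x))   ≡⟨ *-inverse-cancelˡ n⁻¹ ⟦ suc (suc m ℕ.* 2) ⟧ n⁻¹*n≡1 (Pₑ m (suc x)) ⟩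
      Pₑ m (suc x)                                   ≡⟨ Pₑ≡j ⟩
      ⟦ j ⟧                                          ∎)
  c-integral-at-k : IsIntegral (c k)
  c-integral-at-k = newton-integral m c c-integral k k≤m

Pₒ-coeffs : ∀ m a q → (∀ x → Pₒ (suc m) x ≡ newton (suc m) a x) → (∀ x → Pₑ m x ≡ newton m q x) →
  ∀ k → k ≤ m → a (suc k) ≡ ⟦ suc (suc m ℕ.* 2) ⟧ * (q k + Δcoeffs m q k)
Pₒ-coeffs m a q repₒ repₑ = newton-injective m _ _ λ x → begin
  newton m (λ k → a (suc k)) x                         ≡⟨ Pₒ-newton-Δ m a repₒ x ⟩
  ⟦ n ⟧ * Pₑ m (suc x)                                 ≡⟨ cong (⟦ n ⟧ *_) (trans (repₑ (suc x)) (newton-suc m q x)) ⟩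
  ⟦ n ⟧ * newton m (λ k → q k + Δcoeffs m q k) x       ≡⟨ newton-*ˡ m ⟦ n ⟧ _ x ⟩
  newton m (λ k → ⟦ n ⟧ * (q k + Δcoeffs m q k)) x     ∎
  where
  open ≡-Reasoning
  n : ℕ
  n = suc (suc m ℕ.* 2)

Pₑ-coeffs : ∀ m a a′ → (∀ x → Pₑ m x ≡ newton m a x) → (∀ x → Pₒ m x ≡ newton m a′ x) →
  ∀ k → k ≤ m → 2 * a k ≡ a′ k + Δcoeffs m a′ k + ℓ-coeff m k
Pₑ-coeffs m a a′ repₑ repₒ = newton-injective m _ _ λ x → begin
  newton m (λ k → 2 * a k) x                                          ≡⟨ sym (newton-*ˡ m 2 a x) ⟩
  2 * newton m a x                                                    ≡⟨ cong (2 *_) (sym (repₑ x)) ⟩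
  2 * Pₑ m x                                                          ≡⟨ evenFromOdd m x ⟩
  Pₒ m (suc x) + ℓ m x                                                ≡⟨ cong₂ _+_ (trans (repₒ (suc x)) (newton-suc m a′ x)) (prodUp-newton m x) ⟩
  newton m (λ k → a′ k + Δcoeffs m a′ k) x + newton m (ℓ-coeff m) x   ≡⟨ newton-+ m (λ k → a′ k + Δcoeffs m a′ k) (ℓ-coeff m) x ⟩
  newton m (λ k → a′ k + Δcoeffs m a′ k + ℓ-coeff m k) x              ∎
  where open ≡-Reasoning

binomCoeffs⇒newton : ∀ n b {d} → IsBinomCoeffs n b → deg n ≡ d → ∀ x → P n x ≡ newton d (λ k → b (d ∸ k)) x
binomCoeffs⇒newton n b coeffs refl x =
  trans (coeffs x) (trans (sumTo-reverse (deg n) _)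
    (sumTo-cong (deg n) (λ k k≤d → cong (λ t → b (deg n ∸ k) * ⟦ x C t ⟧) (ℕₚ.m∸[m∸n]≡n k≤d))))

m∸[1+[m∸n]]≡n∸1 : ∀ {m n} → 1 ≤ n → n ≤ m → m ∸ suc (m ∸ n) ≡ n ∸ 1
m∸[1+[m∸n]]≡n∸1 {suc m} {suc n} _ (s≤s n≤m) = ℕₚ.m∸[m∸n]≡n n≤m

Δcoeffs-reversed : ∀ m (b : ℕ → ℚ) i → 1 ≤ i → i ≤ m → Δcoeffs m (λ k → b (m ∸ k)) (m ∸ i) ≡ b (i ∸ 1)
Δcoeffs-reversed m b i 1≤i i≤m =
  trans (Δcoeffs-< m _ (m ∸ i) (ℕₚ.∸-monoʳ-< 1≤i i≤m)) (cong b (m∸[1+[m∸n]]≡n∸1 1≤i i≤m))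

odd-coeffs-divisible : ∀ {n b} → (∃ λ m → n ≡ suc (m ℕ.* 2)) → IsBinomCoeffs n b →
  ∀ j → j < deg n → ∃ λ z → b j ≡ ⟦ n ⟧ * ℤ→ℚ z
odd-coeffs-divisible (zero  , refl) coeffs j ()
odd-coeffs-divisible {b = b} (suc m , refl) coeffs j j<deg =
  map₂ (trans (cong b (sym (ℕₚ.m∸[m∸n]≡n j≤m))))
    (Pₒ-coeffs-divisible m (λ k → b (suc m ∸ k)) (binomCoeffs⇒newton (suc (suc m ℕ.* 2)) b coeffs (deg-1+*2 (suc m)))
                         (m ∸ j) (ℕₚ.m∸n≤m m j))
  where
  j≤m : j ≤ m
  j≤m = ℕₚ.≤-pred (subst (j <_) (deg-1+*2 (suc m)) j<deg)

odd-coeffs-recurrence : ∀ {n b b′} → (∃ λ m → n ≡ suc (m ℕ.* 2)) → 3 ≤ n →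
  IsBinomCoeffs n b → IsBinomCoeffs (n ∸ 1) b′ →
  ∀ i → 1 ≤ i → i ≤ deg n ∸ 1 → b i ≡ ⟦ n ⟧ * (b′ i + b′ (i ∸ 1))
odd-coeffs-recurrence (zero , refl) (s≤s ()) _ _ _ _ _
odd-coeffs-recurrence {b = b} {b′} (suc m , refl) _ coeffs coeffs′ i 1≤i i≤deg∸1 = begin
  b i
    ≡⟨ cong b (sym (ℕₚ.m∸[m∸n]≡n i≤m)) ⟩
  b (m ∸ (m ∸ i))
    ≡⟨ Pₒ-coeffs m (λ k → b (suc m ∸ k)) (λ k → b′ (m ∸ k)) (binomCoeffs⇒newton (suc (suc m ℕ.* 2)) b coeffs (deg-1+*2 (suc m)))
                  (binomCoeffs⇒newton (suc (suc (m ℕ.* 2))) b′ coeffs′ (deg-2+*2 m))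
                  (m ∸ i) (ℕₚ.m∸n≤m m i) ⟩
  ⟦ suc (suc m ℕ.* 2) ⟧ * (b′ (m ∸ (m ∸ i)) + Δcoeffs m (λ k → b′ (m ∸ k)) (m ∸ i))
    ≡⟨ cong₂ (λ u v → ⟦ suc (suc m ℕ.* 2) ⟧ * (b′ u + v)) (ℕₚ.m∸[m∸n]≡n i≤m) (Δcoeffs-reversed m b′ i 1≤i i≤m) ⟩
  ⟦ suc (suc m ℕ.* 2) ⟧ * (b′ i + b′ (i ∸ 1))
    ∎
  where
  open ≡-Reasoning
  i≤m : i ≤ m
  i≤m = subst (λ d → i ≤ d ∸ 1) (deg-1+*2 (suc m)) i≤deg∸1

even-coeffs-recurrence : ∀ {n b b′} → (∃ λ m → n ≡ m ℕ.* 2) → 4 ≤ n →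
  IsBinomCoeffs n b → IsBinomCoeffs (n ∸ 1) b′ →
  ∀ i → 1 ≤ i → i ≤ deg n ∸ 1 → 2 * b i ≡ b′ i + b′ (i ∸ 1) + ⟦ deg n ! ℕ.* (deg n C i) ⟧
even-coeffs-recurrence (zero , refl) () _ _ _ _ _
even-coeffs-recurrence {b = b} {b′} (suc m , refl) _ coeffs coeffs′ i 1≤i i≤deg∸1 =
  subst (λ d → 2 * b i ≡ b′ i + b′ (i ∸ 1) + ⟦ d ! ℕ.* (d C i) ⟧) (sym (deg-2+*2 m)) (begin
  2 * b i
    ≡⟨ cong (λ t → 2 * b t) (sym (ℕₚ.m∸[m∸n]≡n i≤m)) ⟩
  2 * b (m ∸ (m ∸ i))
    ≡⟨ Pₑ-coeffs m (λ k → b (m ∸ k)) (λ k → b′ (m ∸ k)) (binomCoeffs⇒newton (suc m ℕ.* 2) b coeffs (deg-2+*2 m))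
                  (binomCoeffs⇒newton (suc (m ℕ.* 2)) b′ coeffs′ (deg-1+*2 m))
                  (m ∸ i) (ℕₚ.m∸n≤m m i) ⟩
  b′ (m ∸ (m ∸ i)) + Δcoeffs m (λ k → b′ (m ∸ k)) (m ∸ i) + ℓ-coeff m (m ∸ i)
    ≡⟨ cong₂ (λ u v → b′ u + v + ℓ-coeff m (m ∸ i)) (ℕₚ.m∸[m∸n]≡n i≤m) (Δcoeffs-reversed m b′ i 1≤i i≤m) ⟩
  b′ i + b′ (i ∸ 1) + ℓ-coeff m (m ∸ i)
    ≡⟨ cong (λ t → b′ i + b′ (i ∸ 1) + ⟦ m ! ℕ.* t ⟧) (sym (nCk≡nC[n∸k] i≤m)) ⟩
  b′ i + b′ (i ∸ 1) + ⟦ m ! ℕ.* (m C i) ⟧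
    ∎)
  where
  open ≡-Reasoning
  i≤m : i ≤ m
  i≤m = ℕₚ.≤-trans (subst (λ d → i ≤ d ∸ 1) (deg-2+*2 m) i≤deg∸1) (ℕₚ.m∸n≤m m 1)

theorem9 :
    -- (1a) odd n: b_j(n)/n ∈ ℤ for j = 0..m-1
    (∀ (n : ℕ) → isOdd n ≡ true → (b : ℕ → ℚ) → IsBinomCoeffs n b →
       ∀ (j : ℕ) → j < deg n → ∃ λ (z : ℤ) → b j ≡ ℕ→ℚ n * ℤ→ℚ z)
    ×
    -- (1b) odd n ≥ 3: b_i(n) = n (b_i(n-1) + b_{i-1}(n-1)) for i = 1..m-1
    (∀ (n : ℕ) → isOdd n ≡ true → 3 ≤ n →
       (b : ℕ → ℚ) → IsBinomCoeffs n b →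
       (b′ : ℕ → ℚ) → IsBinomCoeffs (n ∸ 1) b′ →
       ∀ (i : ℕ) → 1 ≤ i → i ≤ deg n ∸ 1 →
       b i ≡ ℕ→ℚ n * (b′ i + b′ (i ∸ 1)))
    ×
    -- (2) even n ≥ 4: 2 b_i(n) = b_i(n-1) + b_{i-1}(n-1) + m! binom(m,i) for i = 1..m-1
    (∀ (n : ℕ) → isOdd n ≡ false → 4 ≤ n →
       (b : ℕ → ℚ) → IsBinomCoeffs n b →
       (b′ : ℕ → ℚ) → IsBinomCoeffs (n ∸ 1) b′ →
       ∀ (i : ℕ) → 1 ≤ i → i ≤ deg n ∸ 1 →
       ℕ→ℚ 2 * b i ≡ b′ i + b′ (i ∸ 1) + ℕ→ℚ ((deg n) ! ℕ.* (deg n C i)))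
theorem9 =
    (λ n odd b coeffs → odd-coeffs-divisible {n} {b} (isOdd⇒1+*2 odd) coeffs)
  , (λ n odd 3≤n b coeffs b′ coeffs′ → odd-coeffs-recurrence {n} {b} {b′} (isOdd⇒1+*2 odd) 3≤n coeffs coeffs′)
  , (λ n even 4≤n b coeffs b′ coeffs′ → even-coeffs-recurrence {n} {b} {b′} (¬isOdd⇒*2 even) 4≤n coeffs coeffs′)
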